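{- Let $q=2^m$, where $m$ is a positive integer. Then $$f_3(X)=X^{1+q}+X^{1+q^2}+X^{2q+2}$$ is a permutation polynomial over $\mathbb{F}_{q^3}$ if and only if $m\not\equiv 1\pmod 3$.
   Context: A polynomial $f\in\mathbb{F}_{Q}[X]$ is a permutation polynomial over $\mathbb{F}_Q$ if $c\mapsto f(c)$ is a bijection of $\mathbb{F}_Q$. -}

module Defs where

open import Level using (Level; _⊔_)
open import Data.Nat using (ℕ; zero; suc) renaming (_+_ to _+ℕ_; _*_ to _*ℕ_)
open import Data.Fin using (Fin)
open import Data.Product using (∃)
open import Relation.Nullary using (¬_)
open import Algebra.Bundles using (CommutativeRing)
open import Function.Bundles using (Bijection)
open import Function.Definitions using (Bijective)
import Relation.Binary.PropositionalEquality as ≡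

record IsField {c ℓ : Level} (R : CommutativeRing c ℓ) : Set (c ⊔ ℓ) where
  open CommutativeRing R
  field
    0≉1     : ¬ (0# ≈ 1#)
    inverse : ∀ x → ¬ (x ≈ 0#) → ∃ λ y → (x * y) ≈ 1#

HasCardinality : {c ℓ : Level} → CommutativeRing c ℓ → ℕ → Set (c ⊔ ℓ)
HasCardinality R n = Bijection (CommutativeRing.setoid R) (≡.setoid (Fin n))

pow : {c ℓ : Level} (R : CommutativeRing c ℓ) → CommutativeRing.Carrier R → ℕ → CommutativeRing.Carrier R
pow R x zero    = CommutativeRing.1# R
pow R x (suc n) = CommutativeRing._*_ R x (pow R x n)

IsPermutation : {c ℓ : Level} (R : CommutativeRing c ℓ) →
                (CommutativeRing.Carrier R → CommutativeRing.Carrier R) → Set (c ⊔ ℓ)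
IsPermutation R f = Bijective (CommutativeRing._≈_ R) (CommutativeRing._≈_ R) f

f₃ : {c ℓ : Level} (R : CommutativeRing c ℓ) (q : ℕ) →
     CommutativeRing.Carrier R → CommutativeRing.Carrier R
f₃ R q x = pow R x (1 +ℕ q) + pow R x (1 +ℕ q *ℕ q) + pow R x (2 *ℕ q +ℕ 2)
  where
  open CommutativeRing R using (_+_)

{-# OPTIONS --safe #-}
module Submission where

-- Over 𝔽_Q with Q = q³, q = 2^m, factor f₃ = L ∘ ψ where ψ(x) = x^(q+1) and
-- L(u) = u + u^(q²) + u². The map ψ is injective: ψ(x) determines
-- x² = ψ(x) · ψ(x)^(q²) / ψ(x)^q. Since L is additive, f₃ permutes 𝔽_Q iff ker L = 0.
--
-- Let σ(u) = u^q and φ(u) = u² + u. On ker L we have σ² = φ, and σ³ = id, so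
-- u = φ³(u) = u + (u · (u³ + u + 1))². Hence every nonzero u ∈ ker L is a root of
-- X³ + X + 1, so it lies in 𝔽₈ and u^(q²) = u^(4^(m mod 3)). Checking the three
-- cases shows that such a root lies in ker L exactly when m ≡ 1 (mod 3).
--
-- A root always exists because 𝔽₈ ⊆ 𝔽_Q: otherwise the trace T to 𝔽₈ would
-- satisfy T² + T = 0 everywhere, and that polynomial has degree 2·8^(m-1) < Q.

open import Defs
open import Level using (Level; _⊔_)
open import Data.Bool as Bool using (Bool; true; false; _xor_; _∧_; if_then_else_)
open import Data.Empty using (⊥-elim)
open import Data.Fin as Fin using (Fin; zero; suc; punchOut)
open import Data.Fin.Permutation using (Permutation; permutation)
open import Data.Fin.Properties
  using (suc-injective; punchOut-injective; punchInᵢ≢i; injective⇒≤; nonZeroIndex; any?; all?; ¬∀⟶∃¬)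
import Data.Maybe as Maybe
open import Data.Nat as ℕ using (ℕ; zero; suc; _/_; _%_)
open import Data.Nat.DivMod using (m≡m%n+[m/n]*n; m%n<n)
import Data.Nat.Properties as ℕ
open import Data.Nat.Tactic.RingSolver using (solve-∀)
open import Data.Product using (∃; _,_; proj₁; proj₂)
open import Data.Vec.Functional using (removeAt)
open import Function.Base using (_∘_; id; case_of_)
open import Function.Bundles using (Bijection; Equivalence; _⇔_; mk⇔)
open import Function.Definitions
  using (Congruent; Injective; Surjective; StrictlySurjective; Bijective)
open import Relation.Binary.Consequences using (dec⇒weaklyDec)
open import Relation.Binary.Definitions using (Decidable)
open import Relation.Binary.PropositionalEquality as ≡ using (_≡_; _≢_)
open import Relation.Nullary using (¬_; yes; no)
import Relation.Nullary.Decidable as Dec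
open import Algebra.Bundles using (CommutativeMonoid; CommutativeRing; RawRing)
import Algebra.Properties.CommutativeMonoid.Sum as FiniteSum
import Algebra.Properties.Semiring.Exp as Exp
open import Algebra.Solver.Ring.AlmostCommutativeRing
  using (fromCommutativeRing; _-Raw-AlmostCommutative⟶_)
import Algebra.Solver.Ring as RingSolver

Fin-injective⇒surjective : ∀ {n} (f : Fin n → Fin n) → Injective _≡_ _≡_ f →
                           StrictlySurjective _≡_ f
Fin-injective⇒surjective {suc n} f f-injective y with any? (λ i → f i Fin.≟ y)
... | yes hit  = hit
... | no  miss = ⊥-elim (ℕ.1+n≰n (injective⇒≤ punchOut∘f-injective))
  where
  y≢f : ∀ i → y ≢ f i
  y≢f i y≡fi = miss (i , ≡.sym y≡fi)

  punchOut∘f-injective : Injective _≡_ _≡_ (λ i → punchOut (y≢f i))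
  punchOut∘f-injective eq = f-injective (punchOut-injective (y≢f _) (y≢f _) eq)

Fin-injective⇒permutation : ∀ {n} (f : Fin n → Fin n) → Injective _≡_ _≡_ f → Permutation n n
Fin-injective⇒permutation f f-injective =
  permutation f f⁻¹ (proj₂ ∘ surjective) (λ x → f-injective (proj₂ (surjective (f x))))
  where
  surjective : StrictlySurjective _≡_ f
  surjective = Fin-injective⇒surjective f f-injective

  f⁻¹ : Fin _ → Fin _
  f⁻¹ = proj₁ ∘ surjective

module _ {c ℓ : Level} (M : CommutativeMonoid c ℓ) where
  open CommutativeMonoid M
  open FiniteSum M
  open import Relation.Binary.Reasoning.Setoid setoid

  sum-single : ∀ {k} (t : Fin k → Carrier) i → (∀ j → j ≢ i → t j ≈ ε) → sum t ≈ t i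
  sum-single {suc k} t i t≈ε = begin
    sum t                     ≈⟨ sum-remove {i = i} t ⟩
    t i ∙ sum (removeAt t i)  ≈⟨ ∙-congˡ (sum-cong-≋ (λ j → t≈ε _ (punchInᵢ≢i i j))) ⟩
    t i ∙ sum {k} (λ _ → ε)   ≈⟨ ∙-congˡ (sum-replicate-zero k) ⟩
    t i ∙ ε                   ≈⟨ identityʳ (t i) ⟩
    t i                       ∎

module _ {c ℓ : Level} (R : CommutativeRing c ℓ) where
  open CommutativeRing R hiding (zero)
  open Exp semiring using (_^_)
  open import Algebra.Properties.Semiring.Mult semiring using (_×_; ×1-homo-*)

  pow≡^ : ∀ x n → pow R x n ≡ x ^ n
  pow≡^ x zero    = ≡.refl
  pow≡^ x (suc n) = ≡.cong (x *_) (pow≡^ x n)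

  2^k×1≈[1+1]^k : ∀ k → (2 ℕ.^ k) × 1# ≈ (1# + 1#) ^ k
  2^k×1≈[1+1]^k zero    = +-identityʳ 1#
  2^k×1≈[1+1]^k (suc k) =
    trans (×1-homo-* 2 (2 ℕ.^ k)) (*-cong (+-congˡ (+-identityʳ 1#)) (2^k×1≈[1+1]^k k))

module FieldProperties {c ℓ : Level} (F : CommutativeRing c ℓ) (isField : IsField F) where
  open CommutativeRing F hiding (zero)
  open IsField isField
  open Exp semiring using (_^_)
  open FiniteSum *-commutativeMonoid using () renaming (sum to product)
  open import Relation.Binary.Reasoning.Setoid setoid

  *-cancelˡ : ∀ {x y z} → x ≉ 0# → x * y ≈ x * z → y ≈ z
  *-cancelˡ {x} {y} {z} x≉0 xy≈xz = begin
    y              ≈⟨ x⁻¹*[x*w]≈w y ⟨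
    x⁻¹ * (x * y)  ≈⟨ *-congˡ xy≈xz ⟩
    x⁻¹ * (x * z)  ≈⟨ x⁻¹*[x*w]≈w z ⟩
    z              ∎
    where
    x⁻¹ : Carrier
    x⁻¹ = proj₁ (inverse x x≉0)

    x⁻¹*[x*w]≈w : ∀ w → x⁻¹ * (x * w) ≈ w
    x⁻¹*[x*w]≈w w = begin
      x⁻¹ * (x * w)  ≈⟨ *-assoc x⁻¹ x w ⟨
      (x⁻¹ * x) * w  ≈⟨ *-congʳ (trans (*-comm x⁻¹ x) (proj₂ (inverse x x≉0))) ⟩
      1# * w         ≈⟨ *-identityˡ w ⟩
      w              ∎

  *≈0⇒≈0 : ∀ {x y} → x ≉ 0# → x * y ≈ 0# → y ≈ 0#
  *≈0⇒≈0 {x} x≉0 xy≈0 = *-cancelˡ x≉0 (trans xy≈0 (sym (zeroʳ x)))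

  *-nonzero : ∀ {x y} → x ≉ 0# → y ≉ 0# → x * y ≉ 0#
  *-nonzero x≉0 y≉0 xy≈0 = y≉0 (*≈0⇒≈0 x≉0 xy≈0)

  ^-nonzero : ∀ {x} k → x ≉ 0# → x ^ k ≉ 0#
  ^-nonzero zero    _   1≈0 = 0≉1 (sym 1≈0)
  ^-nonzero (suc k) x≉0     = *-nonzero x≉0 (^-nonzero k x≉0)

  product-nonzero : ∀ {k} (t : Fin k → Carrier) → (∀ i → t i ≉ 0#) → product t ≉ 0#
  product-nonzero {zero}  t _   1≈0 = 0≉1 (sym 1≈0)
  product-nonzero {suc k} t t≉0     = *-nonzero (t≉0 zero) (product-nonzero (t ∘ suc) (t≉0 ∘ suc))

module FiniteField {c ℓ : Level} (F : CommutativeRing c ℓ) (isField : IsField F)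
                   {n : ℕ} (card : HasCardinality F n) where
  open CommutativeRing F hiding (zero)
  open IsField isField
  open FieldProperties F isField
  open Exp semiring using (_^_; ^-congˡ)
  open import Algebra.Properties.Ring ring using (+-cancelˡ; +-identityˡ-unique)
  open import Algebra.Properties.Semiring.Mult semiring using (_×_)
  open import Relation.Binary.Reasoning.Setoid setoid
  open Bijection card using (strictlySurjective)
    renaming (to to index; cong to index-cong; injective to index-injective)
  module Σ = FiniteSum +-commutativeMonoid
  module Π = FiniteSum *-commutativeMonoid

  element : Fin n → Carrier
  element i = proj₁ (strictlySurjective i)

  index-element : ∀ i → index (element i) ≡ i
  index-element i = proj₂ (strictlySurjective i)

  element-index : ∀ x → element (index x) ≈ x
  element-index x = index-injective (index-element (index x))

  element-injective : Injective _≡_ _≈_ element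
  element-injective {i} {j} eq =
    ≡.trans (≡.sym (index-element i)) (≡.trans (index-cong eq) (index-element j))

  _≟_ : Decidable _≈_
  x ≟ y = Dec.map′ index-injective index-cong (index x Fin.≟ index y)

  ^≈0⇒≈0 : ∀ {x} k → x ^ suc k ≈ 0# → x ≈ 0#
  ^≈0⇒≈0 {x} k xᵏ⁺¹≈0 with x ≟ 0#
  ... | yes x≈0 = x≈0
  ... | no  x≉0 = ⊥-elim (^-nonzero (suc k) x≉0 xᵏ⁺¹≈0)

  injective⇒bijective : ∀ {f} → Congruent _≈_ _≈_ f → Injective _≈_ _≈_ f → Bijective _≈_ _≈_ f
  injective⇒bijective {f} f-cong f-injective = f-injective , surjective
    where
    surjective : Surjective _≈_ _≈_ f
    surjective y with i , fᵢ≡y ← Fin-injective⇒surjective (index ∘ f ∘ element)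
                                   (element-injective ∘ f-injective ∘ index-injective) (index y)
      = element i , λ z≈eᵢ → trans (f-cong z≈eᵢ) (index-injective fᵢ≡y)

  ∑ ∏ : (Carrier → Carrier) → Carrier
  ∑ g = Σ.sum (g ∘ element)
  ∏ g = Π.sum (g ∘ element)

  module _ {g : Carrier → Carrier} (g-cong : Congruent _≈_ _≈_ g) (g-injective : Injective _≈_ _≈_ g)
           {h : Carrier → Carrier} (h-cong : Congruent _≈_ _≈_ h) where

    reindexing : Permutation n n
    reindexing = Fin-injective⇒permutation (index ∘ g ∘ element)
                   (element-injective ∘ g-injective ∘ index-injective)

    ∑-reindex : ∑ h ≈ ∑ (h ∘ g)
    ∑-reindex = trans (Σ.sum-permute (h ∘ element) reindexing)
                      (Σ.sum-cong-≋ (λ i → h-cong (element-index (g (element i)))))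

    ∏-reindex : ∏ h ≈ ∏ (h ∘ g)
    ∏-reindex = trans (Π.sum-permute (h ∘ element) reindexing)
                      (Π.sum-cong-≋ (λ i → h-cong (element-index (g (element i)))))

  n×1≈0 : n × 1# ≈ 0#
  n×1≈0 = +-identityˡ-unique (n × 1#) (∑ id) (begin
    n × 1# + ∑ id        ≈⟨ +-congʳ (Σ.sum-replicate n) ⟨
    ∑ (λ _ → 1#) + ∑ id  ≈⟨ Σ.∑-distrib-+ (λ _ → 1#) element ⟨
    ∑ (1# +_)            ≈⟨ ∑-reindex +-congˡ (+-cancelˡ 1# _ _) id ⟨
    ∑ id                 ∎)

  characteristic2 : ∀ k → n ≡ 2 ℕ.^ suc k → 1# + 1# ≈ 0#
  characteristic2 k n≡2ᵏ⁺¹ = ^≈0⇒≈0 k (begin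
    (1# + 1#) ^ suc k    ≈⟨ 2^k×1≈[1+1]^k F (suc k) ⟨
    (2 ℕ.^ suc k) × 1#   ≡⟨ ≡.cong (_× 1#) n≡2ᵏ⁺¹ ⟨
    n × 1#               ≈⟨ n×1≈0 ⟩
    0#                   ∎)

  ifZero_then_else_ : Carrier → Carrier → Carrier → Carrier
  ifZero y then a else b with y ≟ 0#
  ... | yes _ = a
  ... | no  _ = b

  ifZero-≈0 : ∀ {y} a b → y ≈ 0# → (ifZero y then a else b) ≈ a
  ifZero-≈0 {y} a b y≈0 with y ≟ 0#
  ... | yes _   = refl
  ... | no  y≉0 = ⊥-elim (y≉0 y≈0)

  ifZero-≉0 : ∀ {y} a b → y ≉ 0# → (ifZero y then a else b) ≈ b
  ifZero-≉0 {y} a b y≉0 with y ≟ 0#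
  ... | yes y≈0 = ⊥-elim (y≉0 y≈0)
  ... | no  _   = refl

  0^k≈0 : ∀ k .{{_ : ℕ.NonZero k}} → 0# ^ k ≈ 0#
  0^k≈0 (suc k) = zeroˡ (0# ^ k)

  -- For a ≉ 0, scaling by a permutes the units, which are the values of κ. Hence
  -- ∏ κ = ∏ (κ ∘ (a *_)) = ∏ ε · ∏ κ, so ∏ ε = 1. Splitting the constant a as
  -- ε y · δ y at every y then gives a^n = ∏ ε · ∏ δ = a, with no exponent n - 1.
  fermat : ∀ a → a ^ n ≈ a
  fermat a with a ≟ 0#
  ... | yes a≈0 = begin
    a ^ n   ≈⟨ ^-congˡ n a≈0 ⟩
    0# ^ n  ≈⟨ 0^k≈0 n {{nonZeroIndex (index 0#)}} ⟩
    0#      ≈⟨ a≈0 ⟨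
    a       ∎
  ... | no a≉0 = begin
    a ^ n                ≈⟨ Π.sum-replicate n ⟨
    ∏ (λ _ → a)          ≈⟨ Π.sum-cong-≋ (ε*δ≈a ∘ element) ⟨
    ∏ (λ y → ε y * δ y)  ≈⟨ Π.∑-distrib-+ (ε ∘ element) (δ ∘ element) ⟩
    ∏ ε * ∏ δ            ≈⟨ *-cong ∏ε≈1 ∏δ≈a ⟩
    1# * a               ≈⟨ *-identityˡ a ⟩
    a                    ∎
    where
    ε δ κ : Carrier → Carrier
    ε y = ifZero y then 1# else a
    δ y = ifZero y then a else 1#
    κ y = ifZero y then 1# else y

    ε*δ≈a : ∀ y → ε y * δ y ≈ a
    ε*δ≈a y with y ≟ 0#
    ... | yes _ = *-identityˡ a
    ... | no  _ = *-identityʳ a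

    ∏δ≈a : ∏ δ ≈ a
    ∏δ≈a = trans (sum-single *-commutativeMonoid (δ ∘ element) (index 0#) δ≈1)
                 (ifZero-≈0 a 1# (element-index 0#))
      where
      δ≈1 : ∀ j → j ≢ index 0# → δ (element j) ≈ 1#
      δ≈1 j j≢ = ifZero-≉0 a 1# λ eⱼ≈0 →
        j≢ (≡.trans (≡.sym (index-element j)) (index-cong eⱼ≈0))

    κ-cong : Congruent _≈_ _≈_ κ
    κ-cong {x} {y} x≈y with x ≟ 0# | y ≟ 0#
    ... | yes _   | yes _   = refl
    ... | yes x≈0 | no  y≉0 = ⊥-elim (y≉0 (trans (sym x≈y) x≈0))
    ... | no  x≉0 | yes y≈0 = ⊥-elim (x≉0 (trans x≈y y≈0))
    ... | no  _   | no  _   = x≈y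

    κ-nonzero : ∀ y → κ y ≉ 0#
    κ-nonzero y with y ≟ 0#
    ... | yes _   = λ 1≈0 → 0≉1 (sym 1≈0)
    ... | no  y≉0 = y≉0

    κ-scale : ∀ y → κ (a * y) ≈ ε y * κ y
    κ-scale y with y ≟ 0# | (a * y) ≟ 0#
    ... | yes _   | yes _    = sym (*-identityˡ 1#)
    ... | yes y≈0 | no  ay≉0 = ⊥-elim (ay≉0 (trans (*-congˡ y≈0) (zeroʳ a)))
    ... | no  y≉0 | yes ay≈0 = ⊥-elim (y≉0 (*≈0⇒≈0 a≉0 ay≈0))
    ... | no  _   | no  _    = refl

    ∏ε≈1 : ∏ ε ≈ 1#
    ∏ε≈1 = *-cancelˡ (product-nonzero (κ ∘ element) (κ-nonzero ∘ element)) (begin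
      ∏ κ * ∏ ε            ≈⟨ *-comm (∏ κ) (∏ ε) ⟩
      ∏ ε * ∏ κ            ≈⟨ Π.∑-distrib-+ (ε ∘ element) (κ ∘ element) ⟨
      ∏ (λ y → ε y * κ y)  ≈⟨ Π.sum-cong-≋ (κ-scale ∘ element) ⟨
      ∏ (κ ∘ (a *_))       ≈⟨ ∏-reindex *-congˡ (*-cancelˡ a≉0) κ-cong ⟨
      ∏ κ                  ≈⟨ *-identityʳ (∏ κ) ⟨
      ∏ κ * 1#             ∎)

HasCharacteristic2 : ∀ {c ℓ} → CommutativeRing c ℓ → Set ℓ
HasCharacteristic2 R = 1# + 1# ≈ 0#
  where open CommutativeRing R

𝔽₂ : RawRing _ _
𝔽₂ = record
  { Carrier = Bool ; _≈_ = _≡_ ; _+_ = _xor_ ; _*_ = _∧_ ; -_ = id ; 0# = false ; 1# = true }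

module Characteristic2 {c ℓ : Level} (R : CommutativeRing c ℓ) (char2 : HasCharacteristic2 R) where
  open CommutativeRing R hiding (zero)
  open Exp semiring using (_^_; ^-congˡ; ^-assocʳ)
  open import Algebra.Properties.Ring ring using (-0#≈0#; +-inverseˡ-unique)
  open import Relation.Binary.Reasoning.Setoid setoid

  fromBool : Bool → Carrier
  fromBool b = if b then 1# else 0#

  𝔽₂⟶R : 𝔽₂ -Raw-AlmostCommutative⟶ fromCommutativeRing R
  𝔽₂⟶R = record
    { ⟦_⟧    = fromBool
    ; +-homo = +-homo
    ; *-homo = *-homo
    ; -‿homo = -‿homo
    ; 0-homo = refl
    ; 1-homo = refl
    }
    where
    +-homo : ∀ a b → fromBool (a xor b) ≈ fromBool a + fromBool b
    +-homo false false = sym (+-identityʳ 0#)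
    +-homo false true  = sym (+-identityˡ 1#)
    +-homo true  false = sym (+-identityʳ 1#)
    +-homo true  true  = sym char2

    *-homo : ∀ a b → fromBool (a ∧ b) ≈ fromBool a * fromBool b
    *-homo false b = sym (zeroˡ (fromBool b))
    *-homo true  b = sym (*-identityˡ (fromBool b))

    -‿homo : ∀ a → fromBool a ≈ - fromBool a
    -‿homo false = sym -0#≈0#
    -‿homo true  = +-inverseˡ-unique 1# 1# char2

  𝔽₂-coefficients≟ : ∀ a b → Maybe.Maybe (fromBool a ≈ fromBool b)
  𝔽₂-coefficients≟ a b = Maybe.map (λ { ≡.refl → refl }) (dec⇒weaklyDec Bool._≟_ a b)

  -- A ring solver with coefficients in 𝔽₂, so that identities which only hold in
  -- characteristic 2, such as (x + y)² = x² + y², are proved by normalisation.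
  open RingSolver 𝔽₂ (fromCommutativeRing R) 𝔽₂⟶R 𝔽₂-coefficients≟ public

  x+x≈0 : ∀ x → x + x ≈ 0#
  x+x≈0 = solve 1 (λ x → x :+ x := con false) refl

  x+y≈0⇒x≈y : ∀ {x y} → x + y ≈ 0# → x ≈ y
  x+y≈0⇒x≈y {x} {y} x+y≈0 =
    trans (+-inverseˡ-unique x y x+y≈0) (sym (+-inverseˡ-unique y y (x+x≈0 y)))

  x≈y⇒x+y≈0 : ∀ {x y} → x ≈ y → x + y ≈ 0#
  x≈y⇒x+y≈0 {x} {y} x≈y = trans (+-congʳ x≈y) (x+x≈0 y)

  frobenius : ∀ k x y → (x + y) ^ (2 ℕ.^ k) ≈ x ^ (2 ℕ.^ k) + y ^ (2 ℕ.^ k)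
  frobenius zero    = solve 2 (λ x y → (x :+ y) :^ 1 := x :^ 1 :+ y :^ 1) refl
  frobenius (suc k) x y = begin
    (x + y) ^ (2 ℕ.* n)          ≈⟨ ^-assocʳ (x + y) 2 n ⟨
    ((x + y) ^ 2) ^ n            ≈⟨ ^-congˡ n (square-homo-+ x y) ⟩
    (x ^ 2 + y ^ 2) ^ n          ≈⟨ frobenius k (x ^ 2) (y ^ 2) ⟩
    (x ^ 2) ^ n + (y ^ 2) ^ n    ≈⟨ +-cong (^-assocʳ x 2 n) (^-assocʳ y 2 n) ⟩
    x ^ (2 ℕ.* n) + y ^ (2 ℕ.* n)  ∎
    where
    n : ℕ
    n = 2 ℕ.^ k

    square-homo-+ : ∀ x y → (x + y) ^ 2 ≈ x ^ 2 + y ^ 2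
    square-homo-+ = solve 2 (λ x y → (x :+ y) :^ 2 := x :^ 2 :+ y :^ 2) refl

  cubic cubic′ : Carrier → Carrier
  cubic  x = x ^ 3 + x + 1#
  cubic′ x = x ^ 3 + x ^ 2 + 1#

  cubic≈0⇒^4≈^2+id : ∀ {w} → cubic w ≈ 0# → w ^ 4 ≈ w ^ 2 + w
  cubic≈0⇒^4≈^2+id {w} cubic≈0 = x+y≈0⇒x≈y (begin
    w ^ 4 + (w ^ 2 + w)  ≈⟨ solve 1 (λ w → w :^ 4 :+ (w :^ 2 :+ w)
                                         := w :* (w :^ 3 :+ w :+ con true)) refl w ⟩
    w * cubic w          ≈⟨ *-congˡ cubic≈0 ⟩
    w * 0#               ≈⟨ zeroʳ w ⟩
    0#                   ∎)

  cubic≈0⇒^8≈id : ∀ {w} → cubic w ≈ 0# → w ^ 8 ≈ w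
  cubic≈0⇒^8≈id {w} cubic≈0 = begin
    w ^ 8              ≈⟨ ^-assocʳ w 4 2 ⟨
    (w ^ 4) ^ 2        ≈⟨ ^-congˡ 2 (cubic≈0⇒^4≈^2+id cubic≈0) ⟩
    (w ^ 2 + w) ^ 2    ≈⟨ solve 1 (λ w → (w :^ 2 :+ w) :^ 2 := w :^ 4 :+ w :^ 2) refl w ⟩
    w ^ 4 + w ^ 2      ≈⟨ +-congʳ (cubic≈0⇒^4≈^2+id cubic≈0) ⟩
    w ^ 2 + w + w ^ 2  ≈⟨ solve 1 (λ w → w :^ 2 :+ w :+ w :^ 2 := w) refl w ⟩
    w                  ∎

  [x²+x]*cubic*cubic′≈x⁸+x : ∀ x → (x ^ 2 + x) * (cubic x * cubic′ x) ≈ x ^ 8 + x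
  [x²+x]*cubic*cubic′≈x⁸+x = solve 1
    (λ x → (x :^ 2 :+ x) :* ((x :^ 3 :+ x :+ con true) :* (x :^ 3 :+ x :^ 2 :+ con true)) := x :^ 8 :+ x) refl

  x*y≈1⇒x³*cubic[y]≈cubic′[x] : ∀ {x y} → x * y ≈ 1# → x ^ 3 * cubic y ≈ cubic′ x
  x*y≈1⇒x³*cubic[y]≈cubic′[x] {x} {y} xy≈1 = begin
    x ^ 3 * cubic y
      ≈⟨ solve 2 (λ x y → x :^ 3 :* (y :^ 3 :+ y :+ con true)
                          := (x :* y) :^ 3 :+ x :^ 2 :* (x :* y) :+ x :^ 3) refl x y ⟩
    (x * y) ^ 3 + x ^ 2 * (x * y) + x ^ 3
      ≈⟨ +-congʳ (+-cong (^-congˡ 3 xy≈1) (*-congˡ xy≈1)) ⟩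
    1# ^ 3 + x ^ 2 * 1# + x ^ 3
      ≈⟨ solve 1 (λ x → con true :^ 3 :+ x :^ 2 :* con true :+ x :^ 3
                       := x :^ 3 :+ x :^ 2 :+ con true) refl x ⟩
    cubic′ x
      ∎

module PolynomialFunctions {c ℓ : Level} (F : CommutativeRing c ℓ) (isField : IsField F) where
  open CommutativeRing F hiding (zero)
  open IsField isField
  open FieldProperties F isField
  open Exp semiring using (_^_)
  open import Algebra.Properties.Ring ring using (x∙y⁻¹≈ε⇒x≈y)
  open import Algebra.Solver.Ring.NaturalCoefficients.Default commutativeSemiring
  open import Data.Product using (_×_)
  open import Relation.Binary.Reasoning.Setoid setoid

  -- Polynomials are represented by the functions they induce, in Horner form:
  -- Poly≤ k f says that f agrees pointwise with a polynomial of degree ≤ k.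
  data Poly≤ : ℕ → (Carrier → Carrier) → Set (c ⊔ ℓ) where
    const  : ∀ {f} a → (∀ x → f x ≈ a) → Poly≤ 0 f
    horner : ∀ {k f g} a → Poly≤ k g → (∀ x → f x ≈ a + x * g x) → Poly≤ (suc k) f

  data Monic : ℕ → (Carrier → Carrier) → Set (c ⊔ ℓ) where
    one    : ∀ {f} → (∀ x → f x ≈ 1#) → Monic 0 f
    horner : ∀ {k f g} a → Monic k g → (∀ x → f x ≈ a + x * g x) → Monic (suc k) f

  const-Poly≤ : ∀ k {f} a → (∀ x → f x ≈ a) → Poly≤ k f
  const-Poly≤ zero    a f≈a = const a f≈a
  const-Poly≤ (suc k) a f≈a = horner a (const-Poly≤ k 0# λ _ → refl)
    λ x → trans (f≈a x) (sym (trans (+-congˡ (zeroʳ x)) (+-identityʳ a)))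

  Poly≤-weaken : ∀ {j k f} → j ℕ.≤ k → Poly≤ j f → Poly≤ k f
  Poly≤-weaken {k = k} _           (const a f≈a)   = const-Poly≤ k a f≈a
  Poly≤-weaken         (ℕ.s≤s j≤k) (horner a p f≈) = horner a (Poly≤-weaken j≤k p) f≈

  horner-+ : ∀ {f g u v : Carrier → Carrier} a b →
             (∀ x → f x ≈ a + x * u x) → (∀ x → g x ≈ b + x * v x) →
             ∀ x → f x + g x ≈ (a + b) + x * (u x + v x)
  horner-+ {u = u} {v} a b f≈ g≈ x = trans (+-cong (f≈ x) (g≈ x))
    (solve 5 (λ x a b u v → (a :+ x :* u) :+ (b :+ x :* v) := (a :+ b) :+ x :* (u :+ v))
       refl x a b (u x) (v x))

  Poly≤-+ : ∀ {k f g} → Poly≤ k f → Poly≤ k g → Poly≤ k (λ x → f x + g x)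
  Poly≤-+ (const a f≈)    (const b g≈)     = const (a + b) (λ x → +-cong (f≈ x) (g≈ x))
  Poly≤-+ (horner a p f≈) (horner b p′ g≈) = horner (a + b) (Poly≤-+ p p′) (horner-+ a b f≈ g≈)

  Monic⇒Poly≤ : ∀ {k f} → Monic k f → Poly≤ k f
  Monic⇒Poly≤ (one f≈1)       = const 1# f≈1
  Monic⇒Poly≤ (horner a p f≈) = horner a (Monic⇒Poly≤ p) f≈

  Monic-+ : ∀ {j k f g} → Monic k f → Poly≤ j g → j ℕ.< k → Monic k (λ x → f x + g x)
  Monic-+ (horner a p f≈) (const b g≈) _ = horner (a + b) p λ x → trans (+-cong (f≈ x) (g≈ x))
    (solve 4 (λ x a b u → (a :+ x :* u) :+ b := (a :+ b) :+ x :* u) refl x a b _)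
  Monic-+ (horner a p f≈) (horner b p′ g≈) (ℕ.s≤s j<k) =
    horner (a + b) (Monic-+ p p′ j<k) (horner-+ a b f≈ g≈)

  x^k-Monic : ∀ k → Monic k (_^ k)
  x^k-Monic zero    = one (λ _ → refl)
  x^k-Monic (suc k) = horner 0# (x^k-Monic k) (λ x → sym (+-identityˡ _))

  horner-divide : ∀ {f g h : Carrier → Carrier} b a →
                  (∀ x → f x ≈ b + x * g x) → (∀ x → g x ≈ (x - a) * h x + g a) →
                  ∀ x → f x ≈ (x - a) * (g a + x * h x) + f a
  horner-divide {f} {g} {h} b a f≈ g≈ x = begin
    f x                                            ≈⟨ f≈ x ⟩
    b + x * g x                                    ≈⟨ +-congˡ (*-congˡ (g≈ x)) ⟩
    b + x * ((x - a) * h x + g a)                  ≈⟨ +-identityʳ _ ⟨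
    b + x * ((x - a) * h x + g a) + 0#             ≈⟨ +-congˡ [a-a]*ga≈0 ⟨
    b + x * ((x - a) * h x + g a) + (a - a) * g a
      ≈⟨ solve 6 (λ x a -a b u v → b :+ x :* ((x :+ -a) :* u :+ v) :+ (a :+ -a) :* v
                   := (x :+ -a) :* (v :+ x :* u) :+ (b :+ a :* v)) refl x a (- a) b (h x) (g a) ⟩
    (x - a) * (g a + x * h x) + (b + a * g a)      ≈⟨ +-congˡ (f≈ a) ⟨
    (x - a) * (g a + x * h x) + f a                ∎
    where
    [a-a]*ga≈0 : (a - a) * g a ≈ 0#
    [a-a]*ga≈0 = trans (*-congʳ (-‿inverseʳ a)) (zeroˡ (g a))

  Monic-divide : ∀ {k f} → Monic (suc k) f → ∀ a →
                 ∃ λ g → Monic k g × (∀ x → f x ≈ (x - a) * g x + f a)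
  Monic-divide (horner {g = g} b (one g≈1) f≈) a =
    (λ x → g a + x * 0#) , one (λ x → trans (ga+x*0≈ga x) (g≈1 a)) , horner-divide b a f≈ g≈
    where
    ga+x*0≈ga : ∀ x → g a + x * 0# ≈ g a
    ga+x*0≈ga x = trans (+-congˡ (zeroʳ x)) (+-identityʳ (g a))

    g≈ : ∀ x → g x ≈ (x - a) * 0# + g a
    g≈ x = trans (trans (g≈1 x) (sym (g≈1 a))) (sym (trans (+-congʳ (zeroʳ (x - a))) (+-identityˡ (g a))))
  Monic-divide (horner {g = g} b p@(horner _ _ _) f≈) a with h , q , g≈ ← Monic-divide p a =
    (λ x → g a + x * h x) , horner (g a) q (λ _ → refl) , horner-divide b a f≈ g≈

  quotient-root : ∀ {f g : Carrier → Carrier} {a b} → (∀ x → f x ≈ (x - a) * g x + f a) →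
                  f a ≈ 0# → f b ≈ 0# → b ≉ a → g b ≈ 0#
  quotient-root {f} {g} {a} {b} f≈ fa≈0 fb≈0 b≉a = *≈0⇒≈0 (b≉a ∘ x∙y⁻¹≈ε⇒x≈y b a) (begin
    (b - a) * g b        ≈⟨ +-identityʳ _ ⟨
    (b - a) * g b + 0#   ≈⟨ +-congˡ fa≈0 ⟨
    (b - a) * g b + f a  ≈⟨ f≈ b ⟨
    f b                  ≈⟨ fb≈0 ⟩
    0#                   ∎)

  Monic-roots≤ : ∀ {k f} → Monic k f → ∀ {r} (root : Fin r → Carrier) → Injective _≡_ _≈_ root →
                 (∀ i → f (root i) ≈ 0#) → r ℕ.≤ k
  Monic-roots≤ _         {zero}  _    _ _   = ℕ.z≤n
  Monic-roots≤ (one f≈1) {suc r} root _ f≈0 = ⊥-elim (0≉1 (trans (sym (f≈0 zero)) (f≈1 (root zero))))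
  Monic-roots≤ p@(horner _ _ _) {suc r} root root-injective f≈0
    with _ , q , f≈ ← Monic-divide p (root zero) =
    ℕ.s≤s (Monic-roots≤ q (root ∘ suc) (suc-injective ∘ root-injective) λ i →
      quotient-root f≈ (f≈0 zero) (f≈0 (suc i)) λ rᵢ₊₁≈r₀ →
        case root-injective {suc i} {zero} rᵢ₊₁≈r₀ of λ ())

8^i<8^i*2 : ∀ i → 8 ℕ.^ i ℕ.< 8 ℕ.^ i ℕ.* 2
8^i<8^i*2 i = ℕ.m<m*n (8 ℕ.^ i) 2 {{ℕ.m^n≢0 8 i}} (ℕ.s≤s (ℕ.s≤s ℕ.z≤n))

8^i*2<8^[1+i] : ∀ i → 8 ℕ.^ i ℕ.* 2 ℕ.< 8 ℕ.^ suc i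
8^i*2<8^[1+i] i = ≡.subst (8 ℕ.^ i ℕ.* 2 ℕ.<_) (ℕ.*-comm (8 ℕ.^ i) 8)
  (ℕ.*-monoʳ-< (8 ℕ.^ i) {{ℕ.m^n≢0 8 i}} (ℕ.s≤s (ℕ.s≤s (ℕ.s≤s ℕ.z≤n))))

[2^m]^3≡8^m : ∀ m → (2 ℕ.^ m) ℕ.^ 3 ≡ 8 ℕ.^ m
[2^m]^3≡8^m m = begin
  (2 ℕ.^ m) ℕ.^ 3  ≡⟨ ℕ.^-*-assoc 2 m 3 ⟩
  2 ℕ.^ (m ℕ.* 3)  ≡⟨ ≡.cong (2 ℕ.^_) (ℕ.*-comm m 3) ⟩
  2 ℕ.^ (3 ℕ.* m)  ≡⟨ ℕ.^-*-assoc 2 3 m ⟨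
  8 ℕ.^ m          ∎
  where open ≡.≡-Reasoning

2^m*2^m≡8^[2d]*4^r : ∀ m → 2 ℕ.^ m ℕ.* 2 ℕ.^ m ≡ 8 ℕ.^ (2 ℕ.* (m / 3)) ℕ.* 4 ℕ.^ (m % 3)
2^m*2^m≡8^[2d]*4^r m = begin
  2 ℕ.^ m ℕ.* 2 ℕ.^ m                          ≡⟨ ℕ.^-distribˡ-+-* 2 m m ⟨
  2 ℕ.^ (m ℕ.+ m)                              ≡⟨ ≡.cong (λ k → 2 ℕ.^ (k ℕ.+ k)) (m≡m%n+[m/n]*n m 3) ⟩
  2 ℕ.^ ((r ℕ.+ d ℕ.* 3) ℕ.+ (r ℕ.+ d ℕ.* 3))  ≡⟨ ≡.cong (2 ℕ.^_) (exponent r d) ⟩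
  2 ℕ.^ (3 ℕ.* e ℕ.+ 2 ℕ.* r)                  ≡⟨ ℕ.^-distribˡ-+-* 2 (3 ℕ.* e) (2 ℕ.* r) ⟩
  2 ℕ.^ (3 ℕ.* e) ℕ.* 2 ℕ.^ (2 ℕ.* r)          ≡⟨ ≡.cong₂ ℕ._*_ (ℕ.^-*-assoc 2 3 e) (ℕ.^-*-assoc 2 2 r) ⟨
  8 ℕ.^ e ℕ.* 4 ℕ.^ r                          ∎
  where
  open ≡.≡-Reasoning
  r = m % 3
  d = m / 3
  e = 2 ℕ.* d

  exponent : ∀ r d → (r ℕ.+ d ℕ.* 3) ℕ.+ (r ℕ.+ d ℕ.* 3) ≡ 3 ℕ.* (2 ℕ.* d) ℕ.+ 2 ℕ.* r
  exponent = solve-∀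

2q+2≡[1+q]*2 : ∀ q → 2 ℕ.* q ℕ.+ 2 ≡ (1 ℕ.+ q) ℕ.* 2
2q+2≡[1+q]*2 = solve-∀

n*n*n≡n^3 : ∀ n → n ℕ.* n ℕ.* n ≡ n ℕ.^ 3
n*n*n≡n^3 n = ≡.trans (ℕ.*-assoc n n n) (≡.cong (λ k → n ℕ.* (n ℕ.* k)) (≡.sym (ℕ.*-identityʳ n)))

module FieldOfOrderPowerOf8 {c ℓ : Level} (F : CommutativeRing c ℓ) (isField : IsField F)
                            (k : ℕ) (card : HasCardinality F (8 ℕ.^ suc k)) where
  open CommutativeRing F hiding (zero)
  open IsField isField
  open FieldProperties F isField
  open FiniteField F isField card
  open PolynomialFunctions F isField
  open Exp semiring using (_^_; ^-congˡ; ^-assocʳ)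
  open import Algebra.Properties.Ring ring using (+-cancelʳ)
  open import Relation.Binary.Reasoning.Setoid setoid

  char2 : HasCharacteristic2 F
  char2 = characteristic2 (k ℕ.+ 2 ℕ.* suc k) (ℕ.^-*-assoc 2 3 (suc k))

  open Characteristic2 F char2

  partialTrace : ℕ → Carrier → Carrier
  partialTrace zero    x = 0#
  partialTrace (suc i) x = x ^ (8 ℕ.^ i) + partialTrace i x

  partialTrace-^8 : ∀ i x → partialTrace i x ^ 8 + x ≈ partialTrace i x + x ^ (8 ℕ.^ i)
  partialTrace-^8 zero    = solve 1 (λ x → con false :^ 8 :+ x := con false :+ x :^ 1) refl
  partialTrace-^8 (suc i) x = begin
    (a + t) ^ 8 + x                ≈⟨ +-congʳ (frobenius 3 a t) ⟩
    a ^ 8 + t ^ 8 + x              ≈⟨ +-assoc (a ^ 8) (t ^ 8) x ⟩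
    a ^ 8 + (t ^ 8 + x)            ≈⟨ +-congˡ (partialTrace-^8 i x) ⟩
    a ^ 8 + (t + a)                ≈⟨ +-comm (a ^ 8) (t + a) ⟩
    (t + a) + a ^ 8                ≈⟨ +-congʳ (+-comm t a) ⟩
    (a + t) + a ^ 8                ≈⟨ +-congˡ (^-assocʳ x (8 ℕ.^ i) 8) ⟩
    (a + t) + x ^ (8 ℕ.^ i ℕ.* 8)  ≡⟨ ≡.cong (λ e → (a + t) + x ^ e) (ℕ.*-comm (8 ℕ.^ i) 8) ⟩
    (a + t) + x ^ (8 ℕ.^ suc i)    ∎
    where
    a t : Carrier
    a = x ^ (8 ℕ.^ i)
    t = partialTrace i x

  trace : Carrier → Carrier
  trace = partialTrace (suc k)

  trace-^8 : ∀ x → trace x ^ 8 ≈ trace x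
  trace-^8 x = +-cancelʳ x _ _ (trans (partialTrace-^8 (suc k) x) (+-congˡ (fermat x)))

  artinSchreier : ℕ → Carrier → Carrier
  artinSchreier zero    x = 0#
  artinSchreier (suc i) x = x ^ (8 ℕ.^ i ℕ.* 2) + (x ^ (8 ℕ.^ i) + artinSchreier i x)

  artinSchreier≈T²+T : ∀ i x → artinSchreier i x ≈ partialTrace i x ^ 2 + partialTrace i x
  artinSchreier≈T²+T zero    _ = solve 0 (con false := con false :^ 2 :+ con false) refl
  artinSchreier≈T²+T (suc i) x = begin
    x ^ (8 ℕ.^ i ℕ.* 2) + (a + artinSchreier i x)
      ≈⟨ +-cong (^-assocʳ x (8 ℕ.^ i) 2) (+-congˡ (sym (artinSchreier≈T²+T i x))) ⟨
    a ^ 2 + (a + (t ^ 2 + t))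
      ≈⟨ solve 2 (λ a t → a :^ 2 :+ (a :+ (t :^ 2 :+ t)) := (a :+ t) :^ 2 :+ (a :+ t)) refl a t ⟩
    (a + t) ^ 2 + (a + t)
      ∎
    where
    a t : Carrier
    a = x ^ (8 ℕ.^ i)
    t = partialTrace i x

  artinSchreier-Poly≤ : ∀ i → Poly≤ (8 ℕ.^ i) (artinSchreier i)
  artinSchreier-Poly≤ zero    = const-Poly≤ 1 0# (λ _ → refl)
  artinSchreier-Poly≤ (suc i) =
    Poly≤-+ (Poly≤-weaken (ℕ.<⇒≤ (8^i*2<8^[1+i] i)) (Monic⇒Poly≤ (x^k-Monic _)))
            (Poly≤-+ (Poly≤-weaken 8^i≤8^[1+i] (Monic⇒Poly≤ (x^k-Monic _)))
                     (Poly≤-weaken 8^i≤8^[1+i] (artinSchreier-Poly≤ i)))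
    where
    8^i≤8^[1+i] : 8 ℕ.^ i ℕ.≤ 8 ℕ.^ suc i
    8^i≤8^[1+i] = ℕ.m≤n*m (8 ℕ.^ i) 8

  artinSchreier-Monic : ∀ i → Monic (8 ℕ.^ i ℕ.* 2) (artinSchreier (suc i))
  artinSchreier-Monic i =
    Monic-+ (x^k-Monic _) (Poly≤-+ (Monic⇒Poly≤ (x^k-Monic _)) (artinSchreier-Poly≤ i)) (8^i<8^i*2 i)

  -- Over 𝔽₂, X⁸ + X = (X² + X)(X³ + X + 1)(X³ + X² + 1), and the roots of the last
  -- factor are the inverses of the roots of X³ + X + 1.
  cubicRoot-from-𝔽₈ : ∀ {u} → u ^ 8 ≈ u → u ^ 2 + u ≉ 0# → ∃ λ w → cubic w ≈ 0#
  cubicRoot-from-𝔽₈ {u} u⁸≈u u²+u≉0 with cubic u ≟ 0#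
  ... | yes cubic≈0 = u , cubic≈0
  ... | no  cubic≉0 = u⁻¹ , *≈0⇒≈0 (^-nonzero 3 u≉0) u³*cubic[u⁻¹]≈0
    where
    cubic′≈0 : cubic′ u ≈ 0#
    cubic′≈0 = *≈0⇒≈0 cubic≉0 (*≈0⇒≈0 u²+u≉0
      (trans ([x²+x]*cubic*cubic′≈x⁸+x u) (x≈y⇒x+y≈0 u⁸≈u)))

    u≉0 : u ≉ 0#
    u≉0 u≈0 = u²+u≉0 (begin
      u ^ 2 + u    ≈⟨ +-cong (^-congˡ 2 u≈0) u≈0 ⟩
      0# ^ 2 + 0#  ≈⟨ solve 0 (con false :^ 2 :+ con false := con false) refl ⟩
      0#           ∎)

    u⁻¹ : Carrier
    u⁻¹ = proj₁ (inverse u u≉0)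

    uu⁻¹≈1 : u * u⁻¹ ≈ 1#
    uu⁻¹≈1 = proj₂ (inverse u u≉0)

    u³*cubic[u⁻¹]≈0 : u ^ 3 * cubic u⁻¹ ≈ 0#
    u³*cubic[u⁻¹]≈0 = trans (x*y≈1⇒x³*cubic[y]≈cubic′[x] uu⁻¹≈1) cubic′≈0

  vanishes? : ∀ i → Dec.Dec (artinSchreier (suc k) (element i) ≈ 0#)
  vanishes? i = artinSchreier (suc k) (element i) ≟ 0#

  -- The trace maps into 𝔽₈; if it only took the values 0 and 1, every element would
  -- be a root of the Artin–Schreier polynomial, which has too small a degree.
  ∃-cubicRoot : ∃ λ w → cubic w ≈ 0#
  ∃-cubicRoot with all? vanishes?
  ... | yes all≈0 = ⊥-elim (ℕ.<⇒≱ (8^i*2<8^[1+i] k)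
                      (Monic-roots≤ (artinSchreier-Monic k) element element-injective all≈0))
  ... | no ¬all≈0 with i , ≉0 ← ¬∀⟶∃¬ _ _ vanishes? ¬all≈0 =
    cubicRoot-from-𝔽₈ (trace-^8 (element i)) (≉0 ∘ trans (artinSchreier≈T²+T (suc k) (element i)))

module F₃Permutation {c ℓ : Level} (F : CommutativeRing c ℓ) (isField : IsField F)
                     (m : ℕ) .{{_ : ℕ.NonZero m}} (card : HasCardinality F ((2 ℕ.^ m) ℕ.^ 3)) where
  open CommutativeRing F hiding (zero)
  open IsField isField
  open FieldProperties F isField
  open FiniteField F isField card
  open Exp semiring using (_^_; ^-congˡ; ^-assocʳ)
  open import Algebra.Properties.CommutativeSemiring.Exp commutativeSemiring using (^-distrib-*)
  open import Algebra.Properties.Ring ring using (+-identityʳ-unique)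
  open import Relation.Binary.Reasoning.Setoid setoid

  q : ℕ
  q = 2 ℕ.^ m

  card₈ : HasCardinality F (8 ℕ.^ suc (ℕ.pred m))
  card₈ = ≡.subst (HasCardinality F) Q≡8^[1+pred[m]] card
    where
    Q≡8^[1+pred[m]] : (2 ℕ.^ m) ℕ.^ 3 ≡ 8 ℕ.^ suc (ℕ.pred m)
    Q≡8^[1+pred[m]] = ≡.trans ([2^m]^3≡8^m m) (≡.cong (8 ℕ.^_) (≡.sym (ℕ.suc-pred m)))

  open FieldOfOrderPowerOf8 F isField (ℕ.pred m) card₈ using (char2; ∃-cubicRoot)
  open Characteristic2 F char2

  σ ψ L φ : Carrier → Carrier
  σ x = x ^ q
  ψ x = x ^ (1 ℕ.+ q)
  L u = u + u ^ (q ℕ.* q) + u ^ 2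
  φ u = u ^ 2 + u

  σ-cong : Congruent _≈_ _≈_ σ
  σ-cong = ^-congˡ q

  σ-homo-+ : ∀ x y → σ (x + y) ≈ σ x + σ y
  σ-homo-+ = frobenius m

  σ-homo-* : ∀ x y → σ (x * y) ≈ σ x * σ y
  σ-homo-* x y = ^-distrib-* x y q

  σ-homo-^ : ∀ x k → σ (x ^ k) ≈ σ x ^ k
  σ-homo-^ x k = begin
    (x ^ k) ^ q    ≈⟨ ^-assocʳ x k q ⟩
    x ^ (k ℕ.* q)  ≡⟨ ≡.cong (x ^_) (ℕ.*-comm k q) ⟩
    x ^ (q ℕ.* k)  ≈⟨ ^-assocʳ x q k ⟨
    (x ^ q) ^ k    ∎

  σ²≈^q² : ∀ x → σ (σ x) ≈ x ^ (q ℕ.* q)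
  σ²≈^q² x = ^-assocʳ x q q

  σ³≈id : ∀ x → σ (σ (σ x)) ≈ x
  σ³≈id x = begin
    σ (σ (σ x))          ≈⟨ σ-cong (σ²≈^q² x) ⟩
    (x ^ (q ℕ.* q)) ^ q  ≈⟨ ^-assocʳ x (q ℕ.* q) q ⟩
    x ^ (q ℕ.* q ℕ.* q)  ≡⟨ ≡.cong (x ^_) (n*n*n≡n^3 q) ⟩
    x ^ (q ℕ.^ 3)        ≈⟨ fermat x ⟩
    x                    ∎

  f₃≈L∘ψ : ∀ x → f₃ F q x ≈ L (ψ x)
  f₃≈L∘ψ x rewrite pow≡^ F x (1 ℕ.+ q) | pow≡^ F x (1 ℕ.+ q ℕ.* q) | pow≡^ F x (2 ℕ.* q ℕ.+ 2) =
    +-cong (+-congˡ x^[1+q²]≈ψ^q²) x^[2q+2]≈ψ²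
    where
    x^[1+q²]≈ψ^q² : x ^ (1 ℕ.+ q ℕ.* q) ≈ ψ x ^ (q ℕ.* q)
    x^[1+q²]≈ψ^q² = begin
      x * x ^ (q ℕ.* q)                  ≈⟨ *-comm x _ ⟩
      x ^ (q ℕ.* q) * x                  ≈⟨ *-congˡ (σ³≈id x) ⟨
      x ^ (q ℕ.* q) * σ (σ (σ x))        ≈⟨ *-congˡ (σ-cong (σ²≈^q² x)) ⟩
      x ^ (q ℕ.* q) * σ (x ^ (q ℕ.* q))  ≈⟨ *-congˡ (σ-homo-^ x (q ℕ.* q)) ⟩
      x ^ (q ℕ.* q) * σ x ^ (q ℕ.* q)    ≈⟨ ^-distrib-* x (σ x) (q ℕ.* q) ⟨
      ψ x ^ (q ℕ.* q)                    ∎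

    x^[2q+2]≈ψ² : x ^ (2 ℕ.* q ℕ.+ 2) ≈ ψ x ^ 2
    x^[2q+2]≈ψ² = begin
      x ^ (2 ℕ.* q ℕ.+ 2)    ≡⟨ ≡.cong (x ^_) (2q+2≡[1+q]*2 q) ⟩
      x ^ ((1 ℕ.+ q) ℕ.* 2)  ≈⟨ ^-assocʳ x (1 ℕ.+ q) 2 ⟨
      ψ x ^ 2                ∎

  ψ-cong : Congruent _≈_ _≈_ ψ
  ψ-cong = ^-congˡ (1 ℕ.+ q)

  σψ*x²≈ψ*σ²ψ : ∀ x → σ (ψ x) * x ^ 2 ≈ ψ x * σ (σ (ψ x))
  σψ*x²≈ψ*σ²ψ x = begin
    σ (x * σ x) * x ^ 2                  ≈⟨ *-congʳ (σ-homo-* x (σ x)) ⟩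
    (σ x * σ (σ x)) * x ^ 2              ≈⟨ solve 3 (λ x y z → (y :* z) :* x :^ 2 := (x :* y) :* (z :* x))
                                                 refl x (σ x) (σ (σ x)) ⟩
    (x * σ x) * (σ (σ x) * x)            ≈⟨ *-congˡ (*-congˡ (σ³≈id x)) ⟨
    (x * σ x) * (σ (σ x) * σ (σ (σ x)))  ≈⟨ *-congˡ (σ-homo-* (σ x) (σ (σ x))) ⟨
    (x * σ x) * σ (σ x * σ (σ x))        ≈⟨ *-congˡ (σ-cong (σ-homo-* x (σ x))) ⟨
    (x * σ x) * σ (σ (x * σ x))          ∎

  ψ-injective : Injective _≈_ _≈_ ψ
  ψ-injective {x} {y} ψx≈ψy with ψ x ≟ 0#
  ... | yes ψx≈0 = trans (^≈0⇒≈0 q ψx≈0) (sym (^≈0⇒≈0 q (trans (sym ψx≈ψy) ψx≈0)))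
  ... | no  ψx≉0 = x+y≈0⇒x≈y (^≈0⇒≈0 1 (begin
    (x + y) ^ 2    ≈⟨ solve 2 (λ x y → (x :+ y) :^ 2 := x :^ 2 :+ y :^ 2) refl x y ⟩
    x ^ 2 + y ^ 2  ≈⟨ x≈y⇒x+y≈0 x²≈y² ⟩
    0#             ∎))
    where
    x²≈y² : x ^ 2 ≈ y ^ 2
    x²≈y² = *-cancelˡ (^-nonzero q ψx≉0) (begin
      σ (ψ x) * x ^ 2    ≈⟨ σψ*x²≈ψ*σ²ψ x ⟩
      ψ x * σ (σ (ψ x))  ≈⟨ *-cong ψx≈ψy (σ-cong (σ-cong ψx≈ψy)) ⟩
      ψ y * σ (σ (ψ y))  ≈⟨ σψ*x²≈ψ*σ²ψ y ⟨
      σ (ψ y) * y ^ 2    ≈⟨ *-congʳ (σ-cong ψx≈ψy) ⟨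
      σ (ψ x) * y ^ 2    ∎)

  L-cong : Congruent _≈_ _≈_ L
  L-cong u≈v = +-cong (+-cong u≈v (^-congˡ (q ℕ.* q) u≈v)) (^-congˡ 2 u≈v)

  L-homo-+ : ∀ u v → L (u + v) ≈ L u + L v
  L-homo-+ u v = begin
    (u + v) + (u + v) ^ (q ℕ.* q) + (u + v) ^ 2
      ≈⟨ +-cong (+-congˡ ^q²-homo-+) (frobenius 1 u v) ⟩
    (u + v) + (u ^ (q ℕ.* q) + v ^ (q ℕ.* q)) + (u ^ 2 + v ^ 2)
      ≈⟨ solve 6 (λ u v u′ v′ u″ v″ → (u :+ v) :+ (u′ :+ v′) :+ (u″ :+ v″)
                                      := (u :+ u′ :+ u″) :+ (v :+ v′ :+ v″))
           refl u v (u ^ (q ℕ.* q)) (v ^ (q ℕ.* q)) (u ^ 2) (v ^ 2) ⟩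
    L u + L v
      ∎
    where
    ^q²-homo-+ : (u + v) ^ (q ℕ.* q) ≈ u ^ (q ℕ.* q) + v ^ (q ℕ.* q)
    ^q²-homo-+ = ≡.subst (λ e → (u + v) ^ e ≈ u ^ e + v ^ e) (ℕ.^-distribˡ-+-* 2 m m)
                         (frobenius (m ℕ.+ m) u v)

  L0≈0 : L 0# ≈ 0#
  L0≈0 = begin
    L 0#         ≈⟨ L-cong (+-identityʳ 0#) ⟨
    L (0# + 0#)  ≈⟨ L-homo-+ 0# 0# ⟩
    L 0# + L 0#  ≈⟨ x+x≈0 (L 0#) ⟩
    0#           ∎

  f₃-cong : Congruent _≈_ _≈_ (f₃ F q)
  f₃-cong {x} {y} x≈y = trans (f₃≈L∘ψ x) (trans (L-cong (ψ-cong x≈y)) (sym (f₃≈L∘ψ y)))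

  f₃-injective⇔L-kernel-trivial : Injective _≈_ _≈_ (f₃ F q) ⇔ (∀ {u} → L u ≈ 0# → u ≈ 0#)
  f₃-injective⇔L-kernel-trivial = mk⇔ to from
    where
    ψ0≈0 : ψ 0# ≈ 0#
    ψ0≈0 = zeroˡ (σ 0#)

    to : Injective _≈_ _≈_ (f₃ F q) → ∀ {u} → L u ≈ 0# → u ≈ 0#
    to f₃-injective {u} Lu≈0 with x , ψx≈u ← proj₂ (injective⇒bijective ψ-cong ψ-injective) u =
      trans (sym (ψx≈u refl)) (trans (ψ-cong x≈0) ψ0≈0)
      where
      x≈0 : x ≈ 0#
      x≈0 = f₃-injective (begin
        f₃ F q x   ≈⟨ f₃≈L∘ψ x ⟩
        L (ψ x)    ≈⟨ L-cong (ψx≈u refl) ⟩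
        L u        ≈⟨ Lu≈0 ⟩
        0#         ≈⟨ L0≈0 ⟨
        L 0#       ≈⟨ L-cong ψ0≈0 ⟨
        L (ψ 0#)   ≈⟨ f₃≈L∘ψ 0# ⟨
        f₃ F q 0#  ∎)

    from : (∀ {u} → L u ≈ 0# → u ≈ 0#) → Injective _≈_ _≈_ (f₃ F q)
    from L-kernel-trivial {x} {y} f₃x≈f₃y = ψ-injective (x+y≈0⇒x≈y (L-kernel-trivial (begin
      L (ψ x + ψ y)        ≈⟨ L-homo-+ (ψ x) (ψ y) ⟩
      L (ψ x) + L (ψ y)    ≈⟨ +-cong (f₃≈L∘ψ x) (f₃≈L∘ψ y) ⟨
      f₃ F q x + f₃ F q y  ≈⟨ x≈y⇒x+y≈0 f₃x≈f₃y ⟩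
      0#                   ∎)))

  φ-cong : Congruent _≈_ _≈_ φ
  φ-cong u≈v = +-cong (^-congˡ 2 u≈v) u≈v

  σφ≈φσ : ∀ u → σ (φ u) ≈ φ (σ u)
  σφ≈φσ u = trans (σ-homo-+ (u ^ 2) u) (+-congʳ (σ-homo-^ u 2))

  L≈0⇒σ²≈φ : ∀ {u} → L u ≈ 0# → σ (σ u) ≈ φ u
  L≈0⇒σ²≈φ {u} Lu≈0 = trans (σ²≈^q² u) (x+y≈0⇒x≈y (begin
    u ^ (q ℕ.* q) + (u ^ 2 + u)  ≈⟨ solve 3 (λ u u′ u″ → u′ :+ (u″ :+ u) := u :+ u′ :+ u″)
                                         refl u (u ^ (q ℕ.* q)) (u ^ 2) ⟩
    L u                          ≈⟨ Lu≈0 ⟩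
    0#                           ∎))

  L≈0⇒φ³≈id : ∀ {u} → L u ≈ 0# → φ (φ (φ u)) ≈ u
  L≈0⇒φ³≈id {u} Lu≈0 = sym (begin
    u            ≈⟨ σ³≈id u ⟨
    σ (σ (σ u))  ≈⟨ σ-cong (L≈0⇒σ²≈φ Lu≈0) ⟩
    σ (φ u)      ≈⟨ σφ≈φσ u ⟩
    φ (σ u)      ≈⟨ φ-cong σ≈φ² ⟩
    φ (φ (φ u))  ∎)
    where
    σ≈φ² : σ u ≈ φ (φ u)
    σ≈φ² = begin
      σ u              ≈⟨ σ³≈id (σ u) ⟨
      σ (σ (σ (σ u)))  ≈⟨ σ-cong (σ-cong (L≈0⇒σ²≈φ Lu≈0)) ⟩
      σ (σ (φ u))      ≈⟨ σ-cong (σφ≈φσ u) ⟩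
      σ (φ (σ u))      ≈⟨ σφ≈φσ (σ u) ⟩
      φ (σ (σ u))      ≈⟨ φ-cong (L≈0⇒σ²≈φ Lu≈0) ⟩
      φ (φ u)          ∎

  L-kernel⊆cubicRoots : ∀ {u} → L u ≈ 0# → u ≉ 0# → cubic u ≈ 0#
  L-kernel⊆cubicRoots {u} Lu≈0 u≉0 = *≈0⇒≈0 u≉0 (^≈0⇒≈0 1 (+-identityʳ-unique u _ (begin
    u + (u * cubic u) ^ 2  ≈⟨ solve 1 (λ u → u :+ (u :* (u :^ 3 :+ u :+ con true)) :^ 2
                                         := Φ (Φ (Φ u))) refl u ⟩
    φ (φ (φ u))            ≈⟨ L≈0⇒φ³≈id Lu≈0 ⟩
    u                      ∎)))
    where
    Φ : Polynomial 1 → Polynomial 1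
    Φ e = e :^ 2 :+ e

  cubic≈0⇒≉0 : ∀ {w} → cubic w ≈ 0# → w ≉ 0#
  cubic≈0⇒≉0 {w} cubic≈0 w≈0 = 0≉1 (begin
    0#                ≈⟨ cubic≈0 ⟨
    w ^ 3 + w + 1#    ≈⟨ +-congʳ (+-cong (^-congˡ 3 w≈0) w≈0) ⟩
    0# ^ 3 + 0# + 1#  ≈⟨ solve 0 (con false :^ 3 :+ con false :+ con true := con true) refl ⟩
    1#                ∎)

  ^8≈id⇒^8^e≈id : ∀ {w} → w ^ 8 ≈ w → ∀ e → w ^ (8 ℕ.^ e) ≈ w
  ^8≈id⇒^8^e≈id {w} _    zero    = *-identityʳ w
  ^8≈id⇒^8^e≈id {w} w⁸≈w (suc e) = begin
    w ^ (8 ℕ.* 8 ℕ.^ e)  ≈⟨ ^-assocʳ w 8 (8 ℕ.^ e) ⟨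
    (w ^ 8) ^ (8 ℕ.^ e)  ≈⟨ ^-congˡ (8 ℕ.^ e) w⁸≈w ⟩
    w ^ (8 ℕ.^ e)        ≈⟨ ^8≈id⇒^8^e≈id w⁸≈w e ⟩
    w                    ∎

  -- L restricted to 𝔽₈, where u^(q²) = u^(4^(m mod 3)).
  L⟨_⟩ : ℕ → Carrier → Carrier
  L⟨ r ⟩ u = u + u ^ (4 ℕ.^ r) + u ^ 2

  cubicRoot-L≈L⟨m%3⟩ : ∀ {w} → cubic w ≈ 0# → L w ≈ L⟨ m % 3 ⟩ w
  cubicRoot-L≈L⟨m%3⟩ {w} cubic≈0 = +-congʳ (+-congˡ (begin
    w ^ (q ℕ.* q)                    ≡⟨ ≡.cong (w ^_) (2^m*2^m≡8^[2d]*4^r m) ⟩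
    w ^ (8 ℕ.^ e ℕ.* 4 ℕ.^ (m % 3))  ≈⟨ ^-assocʳ w (8 ℕ.^ e) (4 ℕ.^ (m % 3)) ⟨
    (w ^ 8 ℕ.^ e) ^ 4 ℕ.^ (m % 3)    ≈⟨ ^-congˡ (4 ℕ.^ (m % 3)) (^8≈id⇒^8^e≈id (cubic≈0⇒^8≈id cubic≈0) e) ⟩
    w ^ (4 ℕ.^ (m % 3))              ∎))
    where
    e : ℕ
    e = 2 ℕ.* (m / 3)

  cubicRoot-L⟨r⟩≈0⇔r≡1 : ∀ {w} → cubic w ≈ 0# → ∀ r → r ℕ.< 3 → (L⟨ r ⟩ w ≈ 0# ⇔ r ≡ 1)
  cubicRoot-L⟨r⟩≈0⇔r≡1 {w} cubic≈0 0 _ =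
    mk⇔ (λ L⟨0⟩w≈0 → ⊥-elim (cubic≈0⇒≉0 cubic≈0 (^≈0⇒≈0 1 (trans (sym L⟨0⟩w≈w²) L⟨0⟩w≈0))))
        λ ()
    where
    L⟨0⟩w≈w² : L⟨ 0 ⟩ w ≈ w ^ 2
    L⟨0⟩w≈w² = solve 1 (λ w → w :+ w :^ 1 :+ w :^ 2 := w :^ 2) refl w
  cubicRoot-L⟨r⟩≈0⇔r≡1 {w} cubic≈0 1 _ = mk⇔ (λ _ → ≡.refl) λ _ → begin
    w + w ^ 4 + w ^ 2        ≈⟨ +-congʳ (+-congˡ (cubic≈0⇒^4≈^2+id cubic≈0)) ⟩
    w + (w ^ 2 + w) + w ^ 2  ≈⟨ solve 1 (λ w → w :+ (w :^ 2 :+ w) :+ w :^ 2 := con false) refl w ⟩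
    0#                       ∎
  cubicRoot-L⟨r⟩≈0⇔r≡1 {w} cubic≈0 2 _ =
    mk⇔ (λ L⟨2⟩w≈0 → ⊥-elim (cubic≈0⇒≉0 cubic≈0 (trans (sym L⟨2⟩w≈w) L⟨2⟩w≈0))) λ ()
    where
    w¹⁶≈w² : w ^ 16 ≈ w ^ 2
    w¹⁶≈w² = trans (sym (^-assocʳ w 8 2)) (^-congˡ 2 (cubic≈0⇒^8≈id cubic≈0))

    L⟨2⟩w≈w : L⟨ 2 ⟩ w ≈ w
    L⟨2⟩w≈w = begin
      w + w ^ 16 + w ^ 2  ≈⟨ +-congʳ (+-congˡ w¹⁶≈w²) ⟩
      w + w ^ 2 + w ^ 2   ≈⟨ solve 1 (λ w → w :+ w :^ 2 :+ w :^ 2 := w) refl w ⟩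
      w                   ∎
  cubicRoot-L⟨r⟩≈0⇔r≡1 _ (suc (suc (suc _))) (ℕ.s≤s (ℕ.s≤s (ℕ.s≤s ())))

  cubicRoot-L≈0⇔m%3≡1 : ∀ {w} → cubic w ≈ 0# → (L w ≈ 0# ⇔ m % 3 ≡ 1)
  cubicRoot-L≈0⇔m%3≡1 {w} cubic≈0 = mk⇔ (to ∘ trans (sym L≈L⟨m%3⟩)) (trans L≈L⟨m%3⟩ ∘ from)
    where
    open Equivalence (cubicRoot-L⟨r⟩≈0⇔r≡1 cubic≈0 (m % 3) (m%n<n m 3))
    L≈L⟨m%3⟩ : L w ≈ L⟨ m % 3 ⟩ w
    L≈L⟨m%3⟩ = cubicRoot-L≈L⟨m%3⟩ cubic≈0

  L-kernel-trivial⇔m%3≢1 : (∀ {u} → L u ≈ 0# → u ≈ 0#) ⇔ (¬ (m % 3 ≡ 1))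
  L-kernel-trivial⇔m%3≢1 = mk⇔ to from
    where
    to : (∀ {u} → L u ≈ 0# → u ≈ 0#) → ¬ (m % 3 ≡ 1)
    to L-kernel-trivial m%3≡1 with w , cubic≈0 ← ∃-cubicRoot =
      cubic≈0⇒≉0 cubic≈0 (L-kernel-trivial (Equivalence.from (cubicRoot-L≈0⇔m%3≡1 cubic≈0) m%3≡1))

    from : ¬ (m % 3 ≡ 1) → ∀ {u} → L u ≈ 0# → u ≈ 0#
    from m%3≢1 {u} Lu≈0 with u ≟ 0#
    ... | yes u≈0 = u≈0
    ... | no  u≉0 = ⊥-elim (m%3≢1 (Equivalence.to (cubicRoot-L≈0⇔m%3≡1 cubic≈0) Lu≈0))
      where
      cubic≈0 : cubic u ≈ 0#
      cubic≈0 = L-kernel⊆cubicRoots Lu≈0 u≉0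

  isPermutation⇔m%3≢1 : IsPermutation F (f₃ F q) ⇔ (¬ (m % 3 ≡ 1))
  isPermutation⇔m%3≢1 = mk⇔
    (to L-kernel-trivial⇔m%3≢1 ∘ to f₃-injective⇔L-kernel-trivial ∘ proj₁)
    (injective⇒bijective f₃-cong ∘ from f₃-injective⇔L-kernel-trivial ∘ from L-kernel-trivial⇔m%3≢1)
    where open Equivalence

open import Data.Nat using (_^_; _≥_)

theorem3p3 : {c ℓ : Level} (m : ℕ) → m ≥ 1 →
    (F : CommutativeRing c ℓ) → IsField F → HasCardinality F ((2 ^ m) ^ 3) →
    IsPermutation F (f₃ F (2 ^ m)) ⇔ (¬ (m % 3 ≡ 1))
theorem3p3 m m≥1 F isField = F₃Permutation.isPermutation⇔m%3≢1 F isField m {{ℕ.>-nonZero m≥1}}
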